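{- For any integers $k,q,m$ with $0\le k<q$ and $m\ge1$, the graph $H_{k,q;m}$ satisfies property $P(k,q;m)$.
   Context: $[n]=\{1,\ldots,n\}$ and $\binom{S}{k}$ denotes the family of $k$-element subsets of $S$. For integers $1\le k<q$, $m\ge1$ and $i\in[q]$, let $\mathcal{F}_i$ be the set of all functions $f:\binom{[q]\setminus\{i\}}{k}\to[m]$; $H_{k,q;m}$ is the graph with vertex set the disjoint union $\bigcup_{i=1}^q\mathcal{F}_i$ in which $f\in\mathcal{F}_i$ and $g\in\mathcal{F}_j$ are adjacent if and only if $i\neq j$ and $f,g$ agree on $\binom{[q]\setminus\{i,j\}}{k}$. For $k=0$, $H_{0,q;m}$ is defined to be $mK_q$, the disjoint union of $m$ copies of the complete graph $K_q$. A graph $G$ satisfies property $P(k,q;m)$ (for integers $0\le k<q$, $m\ge1$) if: (1) all maximal cliques of $G$ have size $q$; (2) each clique of size $k+1$ in $G$ is contained in a unique maximal clique; (3) each clique of size $k$ in $G$ is contained in at least $m$ maximal cliques. (Cliques are vertex sets, the empty set being the clique of size $0$.) -}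

module Defs where

open import Data.Nat using (ℕ; zero; suc)
open import Data.Fin using (Fin)
open import Data.Fin.Subset using (Subset; _∉_; ∣_∣)
open import Data.Product using (Σ; Σ-syntax; _×_; _,_)
open import Data.List using (List; []; _∷_; length)
open import Data.List.Relation.Unary.All using (All)
open import Data.List.Relation.Unary.Any using (Any)
open import Data.List.Relation.Unary.AllPairs using (AllPairs)
open import Relation.Binary.PropositionalEquality using (_≡_)
open import Relation.Nullary using (¬_)

-- A graph: vertex type, an equality on vertices (an equivalence relation,
-- used so that vertices which are functions can be compared extensionally),
-- and an adjacency relation.
record Graph : Set₁ where
  field
    V   : Set
    _≈_ : V → V → Set
    _~_ : V → V → Set

module _ (G : Graph) where
  open Graph G

  _∈ᵥ_ : V → List V → Set
  v ∈ᵥ C = Any (v ≈_) C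

  _⊆ᵥ_ : List V → List V → Set
  S ⊆ᵥ C = All (_∈ᵥ C) S

  _≐_ : List V → List V → Set
  S ≐ C = (S ⊆ᵥ C) × (C ⊆ᵥ S)

  IsClique : List V → Set
  IsClique C = AllPairs (λ x y → (¬ x ≈ y) × (x ~ y)) C

  IsMaximalClique : List V → Set
  IsMaximalClique C = IsClique C × (∀ v → ¬ IsClique (v ∷ C))

  P : ℕ → ℕ → ℕ → Set
  P k q m =
      (∀ C → IsMaximalClique C → length C ≡ q)
    × (∀ S → IsClique S → length S ≡ suc k →
         Σ[ C ∈ List V ] ((IsMaximalClique C × S ⊆ᵥ C)
           × (∀ C' → IsMaximalClique C' → S ⊆ᵥ C' → C' ≐ C)))
    × (∀ S → IsClique S → length S ≡ k →
         Σ[ Cs ∈ List (List V) ] (length Cs ≡ m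
           × All (λ C → IsMaximalClique C × S ⊆ᵥ C) Cs
           × AllPairs (λ C D → ¬ (C ≐ D)) Cs))

-- m K_q : vertices (copy, vertex), adjacent iff same copy, different vertex
mK : ℕ → ℕ → Graph
mK q m = record
  { V   = Fin m × Fin q
  ; _≈_ = _≡_
  ; _~_ = λ { (a , x) (b , y) → (a ≡ b) × ¬ (x ≡ y) }
  }

-- H_{k,q;m} for k ≥ 1.  A vertex f ∈ 𝓕_i is represented as a pair (i , f)
-- with f : Subset q → Fin m, of which only the values on k-subsets of
-- [q] ∖ {i} matter: two representatives are equal iff they have the same
-- index i and agree on all k-subsets of [q] ∖ {i}.
Hgen : ℕ → ℕ → ℕ → Graph
Hgen k q m = record
  { V   = Σ (Fin q) (λ _ → Subset q → Fin m)
  ; _≈_ = λ { (i , f) (j , g) →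
        (i ≡ j) × (∀ (S : Subset q) → ∣ S ∣ ≡ k → i ∉ S → f S ≡ g S) }
  ; _~_ = λ { (i , f) (j , g) →
        (¬ i ≡ j) × (∀ (S : Subset q) → ∣ S ∣ ≡ k → i ∉ S → j ∉ S → f S ≡ g S) }
  }

H : ℕ → ℕ → ℕ → Graph
H zero    q m = mK q m
H (suc k) q m = Hgen (suc k) q m

module Submission where

-- Both H_{0,q;m} = m K_q and H_{k,q;m} (k ≥ 1) come with a position map
-- V → [q] (the index x of a vertex (a , x) of m K_q, the index i of f ∈ 𝓕ᵢ)
-- under which adjacent vertices have different positions.  The proof is
-- organised around transversals: families of pairwise adjacent vertices,
-- one at each position.  For such a "positioned" graph we show, once and for
-- all (module Transversals), that
--   (1) if every clique with a free position can be extended, every maximal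
--       clique has exactly q vertices (counting via finite subsets of Fin q);
--   (2) if S and every maximal clique through S lie along one transversal,
--       that transversal is the unique maximal clique through S;
--   (3) m transversals through S, pairwise different at a fixed position,
--       are m distinct maximal cliques through S.
-- For m K_q the transversals are the copies of K_q.  For H_{k,q;m} a clique
-- C glues to a single function F (on a k-set T, F T is the value of any
-- vertex of C positioned outside T), and the transversal of F extends C;
-- a (k+1)-clique determines F on every k-set, while a k-clique S leaves
-- F free on the k-set of positions of S, giving m choices.

open import Defs
open import Level using (0ℓ)
open import Data.Nat using (ℕ; zero; suc; _<_; _≤_)
open import Data.Nat.Properties using (≤-antisym; <⇒≱; 1+n≰n)
open import Data.Fin using (Fin; zero; suc; _≟_)
open import Data.Fin.Properties using (¬∀⟶∃¬)
open import Data.Fin.Subset using (Subset; ⊥; ⊤; inside; outside; ∣_∣)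
  renaming (_∈_ to _∈ₛ_; _∉_ to _∉ₛ_)
open import Data.Fin.Subset.Properties using (∉⊥; ∈⊤; ∣⊥∣≡0; ∣⊤∣≡n; p⊆q⇒∣p∣≤∣q∣)
  renaming (_∈?_ to _∈ₛ?_)
open import Data.Vec using (_∷_; _[_]≔_; here; there)
open import Data.Vec.Properties using ([]≔-updates; []≔-minimal; []=⇒lookup; lookup⇒[]=; lookup∘update′)
open import Data.List using (List; []; _∷_; [_]; length; map; tabulate)
open import Data.List.Properties using (length-map; length-tabulate)
open import Data.List.Relation.Unary.All as All using (All; []; _∷_)
open import Data.List.Relation.Unary.All.Properties using (tabulate⁺; ¬All⇒Any¬)
open import Data.List.Relation.Unary.AllPairs as AllPairs using (AllPairs; []; _∷_)
import Data.List.Relation.Unary.AllPairs.Properties as AllPairsₚ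
open import Data.List.Relation.Unary.Any using (here; there)
open import Data.List.Relation.Unary.Unique.Propositional using (Unique)
open import Data.List.Membership.Propositional using (_∈_; _∉_; find; lose)
open import Data.List.Membership.Propositional.Properties using (∈-map⁺; ∈-map⁻; ∈-tabulate⁺; ∈-tabulate⁻)
import Data.List.Membership.DecPropositional as DecMembership
open import Data.Product using (Σ-syntax; ∃; _×_; _,_; proj₁; proj₂)
open import Data.Empty using (⊥-elim)
open import Function using (_∘_)
open import Relation.Binary.Core using (Rel)
open import Relation.Binary.Definitions using (Reflexive; Symmetric)
open import Relation.Binary.PropositionalEquality
  using (_≡_; _≢_; refl; sym; trans; cong; subst; subst₂; module ≡-Reasoning)
open import Relation.Nullary using (¬_; yes; no)
open import Relation.Nullary.Decidable using (decidable-stable)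

allPairs-everywhere : ∀ {A : Set} {R : Rel A 0ℓ} {xs x y} → Reflexive R → Symmetric R →
                      AllPairs R xs → x ∈ xs → y ∈ xs → R x y
allPairs-everywhere refl′ sym′ (_  ∷ _)  (here refl) (here refl) = refl′
allPairs-everywhere refl′ sym′ (rx ∷ _)  (here refl) (there y∈) = All.lookup rx y∈
allPairs-everywhere refl′ sym′ (rx ∷ _)  (there x∈) (here refl) = sym′ (All.lookup rx x∈)
allPairs-everywhere refl′ sym′ (_  ∷ rs) (there x∈) (there y∈) =
  allPairs-everywhere refl′ sym′ rs x∈ y∈

∣insert∣ : ∀ {n} (p : Subset n) i → i ∉ₛ p → ∣ p [ i ]≔ inside ∣ ≡ suc ∣ p ∣
∣insert∣ (inside  ∷ p) zero    i∉p = ⊥-elim (i∉p here)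
∣insert∣ (outside ∷ p) zero    i∉p = refl
∣insert∣ (inside  ∷ p) (suc i) i∉p = cong suc (∣insert∣ p i (i∉p ∘ there))
∣insert∣ (outside ∷ p) (suc i) i∉p = ∣insert∣ p i (i∉p ∘ there)

module _ {n : ℕ} where

  ⟦_⟧ : List (Fin n) → Subset n
  ⟦ [] ⟧    = ⊥
  ⟦ i ∷ L ⟧ = ⟦ L ⟧ [ i ]≔ inside

  ∈⟦⟧⁺ : ∀ {L j} → j ∈ L → j ∈ₛ ⟦ L ⟧
  ∈⟦⟧⁺ {i ∷ L} (here refl) = []≔-updates ⟦ L ⟧ i
  ∈⟦⟧⁺ {i ∷ L} {j} (there j∈L) with j ≟ i
  ... | yes refl = []≔-updates ⟦ L ⟧ i
  ... | no  j≢i  = []≔-minimal ⟦ L ⟧ j i j≢i (∈⟦⟧⁺ j∈L)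

  ∈⟦⟧⁻ : ∀ {L j} → j ∈ₛ ⟦ L ⟧ → j ∈ L
  ∈⟦⟧⁻ {[]}    j∈ = ⊥-elim (∉⊥ j∈)
  ∈⟦⟧⁻ {i ∷ L} {j} j∈ with j ≟ i
  ... | yes j≡i = here j≡i
  ... | no  j≢i = there (∈⟦⟧⁻ (lookup⇒[]= j ⟦ L ⟧
                    (trans (sym (lookup∘update′ j≢i ⟦ L ⟧ inside)) ([]=⇒lookup j∈))))

  ∣⟦⟧∣ : ∀ {L} → Unique L → ∣ ⟦ L ⟧ ∣ ≡ length L
  ∣⟦⟧∣ {[]}    []           = ∣⊥∣≡0 n
  ∣⟦⟧∣ {i ∷ L} (i∉L ∷ uniq) =
    trans (∣insert∣ ⟦ L ⟧ i (λ i∈ → All.lookup i∉L (∈⟦⟧⁻ i∈) refl)) (cong suc (∣⟦⟧∣ uniq))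

  unique-inside : ∀ {L T} → Unique L → (∀ {j} → j ∈ L → j ∈ₛ T) → length L ≤ ∣ T ∣
  unique-inside uniq L⊆T = subst (_≤ _) (∣⟦⟧∣ uniq) (p⊆q⇒∣p∣≤∣q∣ (L⊆T ∘ ∈⟦⟧⁻))

  unique-covering : ∀ {L} → Unique L → (∀ j → j ∈ L) → length L ≡ n
  unique-covering {L} uniq covers = ≤-antisym
    (subst (length L ≤_) (∣⊤∣≡n n) (unique-inside {T = ⊤} uniq (λ _ → ∈⊤)))
    (subst₂ _≤_ (∣⊤∣≡n n) (∣⟦⟧∣ uniq) (p⊆q⇒∣p∣≤∣q∣ {p = ⊤} (λ {j} _ → ∈⟦⟧⁺ (covers j))))

  small-subset-misses : ∀ {T : Subset n} → ∣ T ∣ < n → ∃ λ j → j ∉ₛ T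
  small-subset-misses {T} small = ¬∀⟶∃¬ n (_∈ₛ T) (_∈ₛ? T) λ all∈T →
    <⇒≱ small (subst (_≤ ∣ T ∣) (∣⊤∣≡n n) (p⊆q⇒∣p∣≤∣q∣ {p = ⊤} (λ {j} _ → all∈T j)))

module Transversals (G : Graph) {q : ℕ} (pos : Graph.V G → Fin q)
  (adj⇒pos≢ : ∀ {u v} → Graph._~_ G u v → pos u ≢ pos v)
  (≈⇒pos≡ : ∀ {u v} → Graph._≈_ G u v → pos u ≡ pos v)
  (≈-sym : ∀ {u v} → Graph._≈_ G u v → Graph._≈_ G v u)
  where

  open Graph G
  open DecMembership (_≟_ {q}) using (_∈?_)

  -- Adjacent vertices sit at different positions, hence are distinct, so
  -- adjacency alone makes a pair of vertices an edge of a clique.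
  edge : ∀ {u v} → u ~ v → ¬ u ≈ v × u ~ v
  edge u~v = (λ u≈v → adj⇒pos≢ u~v (≈⇒pos≡ u≈v)) , u~v

  clique-unique : ∀ {C} → IsClique G C → Unique (map pos C)
  clique-unique c = AllPairsₚ.map⁺ (AllPairs.map (adj⇒pos≢ ∘ proj₂) c)

  Extendable : Set
  Extendable = ∀ {C} → IsClique G C → ∀ j → j ∉ map pos C → ∃ λ v → IsClique G (v ∷ C)

  maximal-covers : Extendable → ∀ {C} → IsMaximalClique G C → ∀ j → j ∈ map pos C
  maximal-covers extend {C} (c , maximal) j =
    decidable-stable (j ∈? map pos C) (λ j∉C → maximal _ (proj₂ (extend c j j∉C)))

  maximal-size : Extendable → ∀ {C} → IsMaximalClique G C → length C ≡ q
  maximal-size extend {C} mc = trans (sym (length-map pos C))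
    (unique-covering (clique-unique (proj₁ mc)) (maximal-covers extend mc))

  IsTransversal : (Fin q → V) → Set
  IsTransversal f = (∀ j → pos (f j) ≡ j) × (∀ {i j} → i ≢ j → f i ~ f j)

  -- A transversal is a maximal clique: a further vertex would have to be
  -- adjacent to the transversal's vertex at its own position.
  transversal-maximal : ∀ {f} → IsTransversal f → IsMaximalClique G (tabulate f)
  transversal-maximal {f} (pos-f , adjacent) = AllPairsₚ.tabulate⁺ (edge ∘ adjacent) , blocked
    where
    blocked : ∀ v → ¬ IsClique G (v ∷ tabulate f)
    blocked v (v-edges ∷ _) =
      adj⇒pos≢ (proj₂ (All.lookup v-edges (∈-tabulate⁺ (pos v)))) (sym (pos-f (pos v)))

  Along : (Fin q → V) → List V → Set
  Along f C = ∀ {z} → z ∈ C → z ≈ f (pos z)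

  along⇒⊆ : ∀ {f C} → Along f C → _⊆ᵥ_ G C (tabulate f)
  along⇒⊆ along = All.tabulate (λ {z} z∈C → lose (∈-tabulate⁺ (pos z)) (along z∈C))

  maximal-along : Extendable → ∀ {f C} → IsMaximalClique G C → Along f C →
                  _≐_ G C (tabulate f)
  maximal-along extend {f} {C} mc along = along⇒⊆ along , tabulate⁺ covered
    where
    covered : ∀ j → _∈ᵥ_ G (f j) C
    covered j with ∈-map⁻ pos (maximal-covers extend mc j)
    ... | z , z∈C , refl = lose z∈C (≈-sym (along z∈C))

  ⊆-transversal⇒≈ : ∀ {f g} → IsTransversal f → IsTransversal g →
                    _⊆ᵥ_ G (tabulate f) (tabulate g) → ∀ j → f j ≈ g j
  ⊆-transversal⇒≈ {f} {g} (pos-f , _) (pos-g , _) f⊆g j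
    with find (All.lookup f⊆g (∈-tabulate⁺ j))
  ... | w , w∈g , fj≈w with ∈-tabulate⁻ w∈g
  ...   | i , refl = subst (λ i → f j ≈ g i) i≡j fj≈w
    where
    i≡j : i ≡ j
    i≡j = trans (sym (pos-g i)) (trans (sym (≈⇒pos≡ fj≈w)) (pos-f j))

  UniqueMaximalClique : List V → Set
  UniqueMaximalClique S =
    Σ[ C ∈ List V ] ((IsMaximalClique G C × _⊆ᵥ_ G S C)
      × (∀ C' → IsMaximalClique G C' → _⊆ᵥ_ G S C' → _≐_ G C' C))

  unique-maximal : Extendable → ∀ {f S} → IsTransversal f → Along f S →
                   (∀ {C'} → IsMaximalClique G C' → _⊆ᵥ_ G S C' → Along f C') →
                   UniqueMaximalClique S
  unique-maximal extend {f} transversal along forced =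
    tabulate f , (transversal-maximal transversal , along⇒⊆ along)
    , λ C' mc S⊆C' → maximal-along extend mc (forced mc S⊆C')

  DistinctMaximalCliques : ℕ → List V → Set
  DistinctMaximalCliques m S =
    Σ[ Cs ∈ List (List V) ] (length Cs ≡ m
      × All (λ C → IsMaximalClique G C × _⊆ᵥ_ G S C) Cs
      × AllPairs (λ C D → ¬ _≐_ G C D) Cs)

  many-maximal : ∀ {m S} (F : Fin m → Fin q → V) → (∀ d → IsTransversal (F d)) →
                 (∀ d → Along (F d) S) → (j₀ : Fin q) →
                 (∀ {d d'} → d ≢ d' → ¬ F d j₀ ≈ F d' j₀) → DistinctMaximalCliques m S
  many-maximal F transversal along j₀ separated =
    tabulate (tabulate ∘ F) , length-tabulate _
    , tabulate⁺ (λ d → transversal-maximal (transversal d) , along⇒⊆ (along d))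
    , AllPairsₚ.tabulate⁺ (λ d≢d' (Fd⊆Fd' , _) →
        separated d≢d' (⊆-transversal⇒≈ (transversal _) (transversal _) Fd⊆Fd' j₀))

module DisjointCliques (q m : ℕ) where

  open Graph (mK q m)
  open Transversals (mK q m) proj₂ proj₂ (cong proj₂) sym

  same-copy : ∀ {C u v} → IsClique (mK q m) C → u ∈ C → v ∈ C → proj₁ u ≡ proj₁ v
  same-copy c = allPairs-everywhere refl sym (AllPairs.map (proj₁ ∘ proj₂) c)

  -- A clique missing position j is extended by vertex j of its copy
  -- (of copy d if the clique is empty).
  extendable : Fin m → Extendable
  extendable d {[]}          _ j _   = (d , j) , [] ∷ []
  extendable d {(a , x) ∷ C} c j j∉C = (a , j) , All.tabulate joins ∷ c
    where
    joins : ∀ {w} → w ∈ (a , x) ∷ C → ¬ (a , j) ≡ w × (a , j) ~ w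
    joins w∈C = edge (same-copy c (here refl) w∈C
                     , λ j≡ → j∉C (subst (_∈ map proj₂ ((a , x) ∷ C)) (sym j≡)
                                          (∈-map⁺ proj₂ w∈C)))

  copy : Fin m → Fin q → V
  copy a j = a , j

  copy-transversal : ∀ a → IsTransversal (copy a)
  copy-transversal a = (λ _ → refl) , λ i≢j → refl , i≢j

  -- A vertex lies in exactly one copy, and every clique through it lies in that copy.
  vertex-unique-maximal : Fin m → ∀ S → IsClique (mK q m) S → length S ≡ 1 →
                          UniqueMaximalClique S
  vertex-unique-maximal d ((a , x) ∷ []) _ _ =
    unique-maximal (extendable d) (copy-transversal a) (λ { (here refl) → refl }) forced
    where
    forced : ∀ {C'} → IsMaximalClique (mK q m) C' → _⊆ᵥ_ (mK q m) [ (a , x) ] C' →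
             Along (copy a) C'
    forced (c' , _) (ax∈C' ∷ []) {z} z∈C' with find ax∈C'
    ... | _ , w∈C' , refl = cong (_, proj₂ z) (same-copy c' z∈C' w∈C')

  -- The empty clique lies in each of the m copies.
  empty-distinct-maximal : Fin q → ∀ S → IsClique (mK q m) S → length S ≡ 0 →
                           DistinctMaximalCliques m S
  empty-distinct-maximal j₀ [] _ _ =
    many-maximal copy copy-transversal (λ _ ()) j₀ (λ d≢d' → d≢d' ∘ cong proj₁)

  -- P(0,q;m), given some copy d and some position j₀ (that is, m ≥ 1 and q ≥ 1).
  property : Fin m → Fin q → P (mK q m) 0 q m
  property d j₀ =
    (λ _ → maximal-size (extendable d)) , vertex-unique-maximal d , empty-distinct-maximal j₀

module FunctionGraphs (k q m : ℕ) where

  open Graph (Hgen k q m)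

  ≈-sym : ∀ {u v} → u ≈ v → v ≈ u
  ≈-sym (refl , agree) = refl , λ T |T| i∉T → sym (agree T |T| i∉T)

  open Transversals (Hgen k q m) proj₁ proj₁ proj₁ ≈-sym

  Agree : V → V → Set
  Agree u v = ∀ T → ∣ T ∣ ≡ k → proj₁ u ∉ₛ T → proj₁ v ∉ₛ T → proj₂ u T ≡ proj₂ v T

  clique-agrees : ∀ {C u v} → IsClique (Hgen k q m) C → u ∈ C → v ∈ C → Agree u v
  clique-agrees c = allPairs-everywhere (λ _ _ _ _ → refl)
    (λ agree T |T| v∉T u∉T → sym (agree T |T| u∉T v∉T)) (AllPairs.map (proj₂ ∘ proj₂) c)

  -- The function determined by a clique C: on a set T its value is that of
  -- the first vertex of C positioned outside T, and d if there is none.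
  glue : Fin m → List V → Subset q → Fin m
  glue d []            T = d
  glue d ((i , f) ∷ C) T with i ∈ₛ? T
  ... | yes _ = glue d C T
  ... | no  _ = f T

  glue-outside : ∀ {d C i f T} → IsClique (Hgen k q m) C → (i , f) ∈ C →
                 ∣ T ∣ ≡ k → i ∉ₛ T → glue d C T ≡ f T
  glue-outside {C = (i' , f') ∷ C} {T = T} (head ∷ c) v∈C |T| i∉T with i' ∈ₛ? T | v∈C
  ... | yes i'∈T | here refl  = ⊥-elim (i∉T i'∈T)
  ... | yes _    | there v∈C' = glue-outside c v∈C' |T| i∉T
  ... | no  _    | here refl  = refl
  ... | no  i'∉T | there v∈C' = proj₂ (proj₂ (All.lookup head v∈C')) T |T| i'∉T i∉T

  glue-inside : ∀ {d C T} → All (λ v → proj₁ v ∈ₛ T) C → glue d C T ≡ d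
  glue-inside {C = []} _ = refl
  glue-inside {C = (i , f) ∷ C} {T} (i∈T ∷ rest∈T) with i ∈ₛ? T
  ... | yes _   = glue-inside rest∈T
  ... | no  i∉T = ⊥-elim (i∉T i∈T)

  placed : (Subset q → Fin m) → Fin q → V
  placed F j = j , F

  placed-transversal : ∀ F → IsTransversal (placed F)
  placed-transversal F = (λ _ → refl) , λ i≢j → i≢j , λ _ _ _ _ → refl

  glue-along : ∀ {d S} → IsClique (Hgen k q m) S → Along (placed (glue d S)) S
  glue-along s v∈S = refl , λ T |T| i∉T → sym (glue-outside s v∈S |T| i∉T)

  extendable : Fin m → Extendable
  extendable d {C} c j j∉C = (j , glue d C) , All.tabulate joins ∷ c
    where
    joins : ∀ {w} → w ∈ C → ¬ (j , glue d C) ≈ w × (j , glue d C) ~ w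
    joins w∈C = edge ((λ j≡ → j∉C (subst (_∈ map proj₁ C) (sym j≡) (∈-map⁺ proj₁ w∈C)))
                     , λ T |T| _ i∉T → glue-outside c w∈C |T| i∉T)

  ∣positions∣ : ∀ {S} → IsClique (Hgen k q m) S → ∣ ⟦ map proj₁ S ⟧ ∣ ≡ length S
  ∣positions∣ {S} s = trans (∣⟦⟧∣ (clique-unique s)) (length-map proj₁ S)

  escapes : ∀ {S T} → IsClique (Hgen k q m) S → length S ≡ suc k → ∣ T ∣ ≡ k →
            ∃ λ y → y ∈ S × proj₁ y ∉ₛ T
  escapes {S} {T} s |S| |T| = find (¬All⇒Any¬ (λ y → proj₁ y ∈ₛ? T) S all-inside⇒⊥)
    where
    all-inside⇒⊥ : ¬ All (λ y → proj₁ y ∈ₛ T) S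
    all-inside⇒⊥ all∈T = 1+n≰n (subst₂ _≤_ (trans (length-map proj₁ S) |S|) |T|
      (unique-inside (clique-unique s) λ j∈ → let y , y∈S , j≡ = ∈-map⁻ proj₁ j∈ in
        subst (_∈ₛ T) (sym j≡) (All.lookup all∈T y∈S)))

  superclique-along : ∀ {d S C'} → IsClique (Hgen k q m) S → length S ≡ suc k →
                      IsClique (Hgen k q m) C' → _⊆ᵥ_ (Hgen k q m) S C' →
                      Along (placed (glue d S)) C'
  superclique-along {d} {S} s |S| c' S⊆C' {z} z∈C' = refl , agrees
    where
    agrees : ∀ T → ∣ T ∣ ≡ k → proj₁ z ∉ₛ T → proj₂ z T ≡ glue d S T
    agrees T |T| z∉T with escapes s |S| |T|
    ... | y , y∈S , y∉T with find (All.lookup S⊆C' y∈S)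
    ...   | w , w∈C' , (y≡w , y≈w) = begin
      proj₂ z T   ≡⟨ clique-agrees c' z∈C' w∈C' T |T| z∉T (subst (_∉ₛ T) y≡w y∉T) ⟩
      proj₂ w T   ≡⟨ sym (y≈w T |T| y∉T) ⟩
      proj₂ y T   ≡⟨ sym (glue-outside s y∈S |T| y∉T) ⟩
      glue d S T  ∎
      where open ≡-Reasoning

  -- P(k,q;m), given a default value d (that is, m ≥ 1) and k < q.
  property : Fin m → k < q → P (Hgen k q m) k q m
  property d k<q = (λ _ → maximal-size (extendable d)) , unique-above , distinct-above
    where
    -- A (k+1)-clique fixes its glued function on all k-sets.
    unique-above : ∀ S → IsClique (Hgen k q m) S → length S ≡ suc k → UniqueMaximalClique S
    unique-above S s |S| =
      unique-maximal (extendable d) (placed-transversal (glue d S)) (glue-along s)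
        (λ mc S⊆C' → superclique-along s |S| (proj₁ mc) S⊆C')

    -- The m glued functions of a k-clique S differ on the k-set of its positions.
    distinct-above : ∀ S → IsClique (Hgen k q m) S → length S ≡ k → DistinctMaximalCliques m S
    distinct-above S s |S| =
      many-maximal (λ d → placed (glue d S)) (λ d → placed-transversal (glue d S))
        (λ _ → glue-along s) j₀ separated
      where
      T : Subset q
      T = ⟦ map proj₁ S ⟧
      |T| : ∣ T ∣ ≡ k
      |T| = trans (∣positions∣ s) |S|
      S-inside : All (λ v → proj₁ v ∈ₛ T) S
      S-inside = All.tabulate (∈⟦⟧⁺ ∘ ∈-map⁺ proj₁)
      misses : ∃ λ j → j ∉ₛ T
      misses = small-subset-misses (subst (_< q) (sym |T|) k<q)
      j₀ : Fin q
      j₀ = proj₁ misses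
      separated : ∀ {d d'} → d ≢ d' → ¬ (j₀ , glue d S) ≈ (j₀ , glue d' S)
      separated {d} {d'} d≢d' (_ , agree) = d≢d' (begin
        d           ≡⟨ sym (glue-inside S-inside) ⟩
        glue d S T  ≡⟨ agree T |T| (proj₂ misses) ⟩
        glue d' S T ≡⟨ glue-inside S-inside ⟩
        d'          ∎)
        where open ≡-Reasoning

-- m ≥ 1 supplies a default value, q > k a free position; in the case k = 0
-- the graph is m K_q, otherwise it is the function graph.
theorem2p3 : (k q m : ℕ) → k < q → 1 ≤ m → P (H k q m) k q m
theorem2p3 k       q       zero    _   ()
theorem2p3 zero    zero    (suc m) ()  _
theorem2p3 zero    (suc q) (suc m) _   _ = DisjointCliques.property (suc q) (suc m) zero zero
theorem2p3 (suc k) q       (suc m) k<q _ = FunctionGraphs.property (suc k) q (suc m) zero k<q
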